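{- Let $G$ be a graph containing distinct vertices $s$ and $t$, and let $v\in V(G)\setminus\{s,t\}$. Then $v$ belongs to some minimal $st$-separator of $G$ if and only if there is an induced path in $G$ between $s$ and $t$ containing $v$.
   Context: All graphs are finite, simple and undirected. An $st$-separator is a set $Z\subseteq V(G)\setminus\{s,t\}$ such that $G-Z$ has no $s$–$t$ path; it is minimal if no proper subset of it is an $st$-separator. A path is induced if the subgraph of $G$ induced by its vertex set is the path itself. -}

module Defs where

open import Data.Nat using (ℕ; suc; _+_)
open import Data.Fin using (Fin; toℕ)
open import Data.Fin.Subset using (Subset; _∈_; _∉_; _⊂_)
open import Data.List using (List; []; _∷_; length; lookup; head; last)
open import Data.List.Relation.Unary.All using (All)
open import Data.List.Relation.Unary.Unique.Propositional using (Unique)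
open import Data.Maybe using (just)
open import Data.Product using (Σ; _×_; _,_)
open import Data.Sum using (_⊎_)
open import Relation.Nullary using (¬_; Dec)
open import Relation.Binary.PropositionalEquality using (_≡_)

record Graph (n : ℕ) : Set₁ where
  field
    Adj     : Fin n → Fin n → Set
    adj?    : ∀ u v → Dec (Adj u v)
    sym     : ∀ {u v} → Adj u v → Adj v u
    irrefl  : ∀ {u} → ¬ Adj u u
open Graph public

module _ {n : ℕ} (G : Graph n) where

  data IsWalk : List (Fin n) → Set where
    []  : IsWalk []
    [_] : ∀ x → IsWalk (x ∷ [])
    _∷_ : ∀ {x y xs} → Adj G x y → IsWalk (y ∷ xs) → IsWalk (x ∷ y ∷ xs)

  record Path (s t : Fin n) : Set where
    field
      verts  : List (Fin n)
      walk   : IsWalk verts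
      unique : Unique verts
      start  : head verts ≡ just s
      end    : last verts ≡ just t
  open Path public

  -- induced: two vertices of the path are adjacent in G only if they are
  -- consecutive on the path (so the induced subgraph is the path itself)
  Induced : ∀ {s t} → Path s t → Set
  Induced P = ∀ (i j : Fin (length (verts P))) →
    Adj G (lookup (verts P) i) (lookup (verts P) j) →
    (suc (toℕ i) ≡ toℕ j) ⊎ (suc (toℕ j) ≡ toℕ i)

  Avoids : ∀ {s t} → Path s t → Subset n → Set
  Avoids P Z = All (λ x → x ∉ Z) (verts P)

  IsSeparator : Fin n → Fin n → Subset n → Set
  IsSeparator s t Z = s ∉ Z × t ∉ Z × (∀ (P : Path s t) → ¬ Avoids P Z)

  IsMinimalSeparator : Fin n → Fin n → Subset n → Set
  IsMinimalSeparator s t Z =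
    IsSeparator s t Z × (∀ Z′ → Z′ ⊂ Z → ¬ IsSeparator s t Z′)

{-# OPTIONS --safe #-}
-- (⇐) Let P be an induced s–t path through v. The vertices off P, together with v, separate
-- s from t: a walk avoiding them stays on P, and since P is induced each step moves one position
-- along P, so the walk never gets past v. Any minimal separator inside this one contains v,
-- for otherwise P avoids it.
-- (⇒) If Z is minimal and v ∈ Z, then Z − v is not a separator, so some s–t path avoids it.
-- Shortcutting that path at chords yields an induced path on a subset of its vertices; this
-- path still avoids Z − v but must meet Z, so it passes through v.
-- Constructively, "not a separator" yields a path because paths have at most n vertices and the
-- lists of bounded length over Fin n can be searched exhaustively.
module Submission where

open import Defs hiding (sym)
open import Data.Nat using (ℕ)
open import Data.Fin using (Fin)
open import Data.Fin.Subset using (Subset; _∈_)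
open import Data.List.Membership.Propositional using () renaming (_∈_ to _∈ₗ_)
open import Data.Product using (Σ; _×_)
open import Function.Bundles using (_⇔_)
open import Relation.Nullary using (¬_)
open import Relation.Binary.PropositionalEquality using (_≡_)

open import Level using (Level)
open import Data.Empty using (⊥-elim)
open import Data.Nat.Base using (suc; _≤_; _<_; _^_; z≤n; s≤s)
open import Data.Nat.Properties
  using (anyUpTo?; _≤?_; ≰⇒>; ≤∧≢⇒<; <⇒≱; <-trans; ≤-reflexive; n≢0⇒n>0)
open import Data.Fin.Base using (toℕ; finToFun; funToFin) renaming (zero to fzero; suc to fsuc)
open import Data.Fin.Properties using (_≟_; any?; pigeonhole; toℕ-injective; finToFun-funToFin)
import Data.Fin.Properties as Fin
open import Data.Fin.Subset using (_∉_; _⊆_; _⊂_; _-_; ⁅_⁆; ∁)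
open import Data.Fin.Subset.Properties
  using (_∈?_; _⊂?_; anySubset?; p─q⊆p; x∈p⇒p-x⊂p; x∈p∧x≢y⇒x∈p-y; x∈p⇒x∉∁p; x∉∁p⇒x∈p)
open import Data.Fin.Subset.Induction using (⊂-wellFounded; Acc; acc)
open import Data.List.Base using (List; []; _∷_; _++_; length; lookup; head; last; tabulate)
open import Data.List.Properties using (tabulate-cong; tabulate-lookup)
open import Data.List.Relation.Unary.All as All using (All; []; _∷_; all?)
open import Data.List.Relation.Unary.All.Properties using (anti-mono)
open import Data.List.Relation.Unary.All.Properties.Core using (¬Any⇒All¬)
open import Data.List.Relation.Unary.Any as Any using (Any; here; there)
open import Data.List.Relation.Unary.Any.Properties using (lookup-index)
open import Data.List.Relation.Unary.Unique.Propositional using (Unique; []; _∷_)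
import Data.List.Relation.Unary.Unique.DecPropositional as UniqueDec
open import Data.List.Membership.Propositional.Properties using (∈-lookup)
import Data.List.Membership.DecPropositional as MembershipDec
open import Data.List.Relation.Binary.Subset.Propositional using () renaming (_⊆_ to _⊆ₗ_)
open import Data.List.Relation.Binary.Subset.Propositional.Properties using (xs⊆ys++xs; ∷⁺ʳ)
open import Data.Maybe.Base using (just)
import Data.Maybe.Properties as Maybe
open import Data.Product using (∃; ∃₂; _,_; proj₁; proj₂; curry; uncurry)
open import Data.Sum using (_⊎_; inj₁; inj₂; [_,_]′)
import Data.Vec.Base as Vec
open import Data.Vec.Properties using (lookup∘tabulate; []=⇒lookup; lookup⇒[]=)
open import Function.Base using (_∘_; id)
open import Function.Bundles using (mk⇔)
open import Relation.Nullary using (Dec; yes; no; ¬?; does; contradiction)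
open import Relation.Nullary.Decidable using (_×-dec_; map′; decidable-stable; dec-true)
open import Relation.Unary using (Pred; Decidable)
open import Relation.Binary.PropositionalEquality
  using (_≢_; refl; sym; trans; cong; subst; subst₂; module ≡-Reasoning)

private
  variable
    a : Level
    n : ℕ

module _ {A : Set a} where

  Unique⇒lookup-injective : ∀ {xs : List A} → Unique xs →
                            ∀ i j → lookup xs i ≡ lookup xs j → i ≡ j
  Unique⇒lookup-injective (_   ∷ _) fzero    fzero    _  = refl
  Unique⇒lookup-injective (x∉ ∷ _) fzero    (fsuc j) eq = contradiction eq (All.lookup x∉ (∈-lookup j))
  Unique⇒lookup-injective (x∉ ∷ _) (fsuc i) fzero    eq =
    contradiction (sym eq) (All.lookup x∉ (∈-lookup i))
  Unique⇒lookup-injective (_   ∷ u) (fsuc i) (fsuc j) eq = cong fsuc (Unique⇒lookup-injective u i j eq)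

  last⇒∈ : ∀ {xs : List A} {x} → last xs ≡ just x → x ∈ₗ xs
  last⇒∈ {_ ∷ []}     refl = here refl
  last⇒∈ {_ ∷ y ∷ xs} eq   = there (last⇒∈ {y ∷ xs} eq)

  head⇒∈ : ∀ {xs : List A} {x} → head xs ≡ just x → x ∈ₗ xs
  head⇒∈ {_ ∷ _} refl = here refl

  head⇒lookup-zero : ∀ {xs : List A} {x} → head xs ≡ just x →
                     ∃ λ i → lookup xs i ≡ x × toℕ i ≡ 0
  head⇒lookup-zero {_ ∷ _} refl = fzero , refl , refl

  Unique⇒last-index-maximal : ∀ {xs : List A} {x} → Unique xs → last xs ≡ just x →
                              ∀ j → lookup xs j ≡ x → (k : Fin (length xs)) → toℕ k ≤ toℕ j
  Unique⇒last-index-maximal {_ ∷ []}     _        _  fzero    _    fzero    = z≤n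
  Unique⇒last-index-maximal {_ ∷ y ∷ xs} (x∉ ∷ _) eq fzero    refl _        =
    contradiction refl (All.lookup x∉ (last⇒∈ {y ∷ xs} eq))
  Unique⇒last-index-maximal {_ ∷ _ ∷ _}  _        _  (fsuc _) _    fzero    = z≤n
  Unique⇒last-index-maximal {_ ∷ y ∷ xs} (_ ∷ u)  eq (fsuc j) e    (fsuc k) =
    s≤s (Unique⇒last-index-maximal {y ∷ xs} u eq j e k)

  last-++ : ∀ pre {y} (ys : List A) → last (pre ++ y ∷ ys) ≡ last (y ∷ ys)
  last-++ []            _  = refl
  last-++ (_ ∷ [])      _  = refl
  last-++ (_ ∷ x ∷ pre) ys = last-++ (x ∷ pre) ys

  TailClosed : ∀ {ℓ} → Pred (List A) ℓ → Set _
  TailClosed P = ∀ {x xs} → P (x ∷ xs) → P xs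

  TailClosed⇒++⁻ʳ : ∀ {ℓ} {P : Pred (List A) ℓ} → TailClosed P → ∀ pre {ys} → P (pre ++ ys) → P ys
  TailClosed⇒++⁻ʳ         tail []        pys = pys
  TailClosed⇒++⁻ʳ {P = P} tail (_ ∷ pre) pys = TailClosed⇒++⁻ʳ {P = P} tail pre (tail pys)

  module _ {ℓ} {P : Pred A ℓ} (P? : Decidable P) where

    splitAtLast : ∀ {xs} → Any P xs →
                  ∃₂ λ pre z → ∃ λ r → xs ≡ pre ++ z ∷ r × P z × All (¬_ ∘ P) r
    splitAtLast {x ∷ xs} pxs with Any.any? P? xs
    ... | yes pxs′ with pre , z , r , refl , pz , ¬pr ← splitAtLast pxs′
      = x ∷ pre , z , r , refl , pz , ¬pr
    ... | no ¬pxs′ =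
      [] , x , xs , refl , [ id , (λ q → contradiction q ¬pxs′) ]′ (Any.toSum pxs) , ¬Any⇒All¬ xs ¬pxs′

Unique⇒length≤ : ∀ {xs : List (Fin n)} → Unique xs → length xs ≤ n
Unique⇒length≤ {n} {xs} u with length xs ≤? n
... | yes ≤n = ≤n
... | no  ≰n with i , j , i<j , eq ← pigeonhole (≰⇒> ≰n) (lookup xs)
  = contradiction (Unique⇒lookup-injective u i j eq) (Fin.<⇒≢ i<j)

module _ {n : ℕ} where

  decode : ∀ k → Fin (n ^ k) → List (Fin n)
  decode k c = tabulate (finToFun {n} {k} c)

  decode-encode : (xs : List (Fin n)) → decode (length xs) (funToFin (lookup xs)) ≡ xs
  decode-encode xs = trans (tabulate-cong (finToFun-funToFin (lookup xs))) (tabulate-lookup xs)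

  bounded-any? : ∀ {ℓ} {P : Pred (List (Fin n)) ℓ} → Decidable P →
                 ∀ m → (∀ {xs} → P xs → length xs ≤ m) → Dec (∃ P)
  bounded-any? {P = P} P? m bound = map′
    (λ (k , _ , c , pc) → decode k c , pc)
    (λ (xs , pxs) → length xs , s≤s (bound pxs) , funToFin (lookup xs) ,
                    subst P (sym (decode-encode xs)) pxs)
    (anyUpTo? (λ k → any? (P? ∘ decode k)) (suc m))

module _ {p} {P : Pred (Subset n) p} (P? : Decidable P) where

  ⊂-minimal-⊆ : ∀ {Z} → P Z → ∃ λ Z′ → Z′ ⊆ Z × P Z′ × (∀ Z″ → Z″ ⊂ Z′ → ¬ P Z″)
  ⊂-minimal-⊆ = go (⊂-wellFounded _)
    where
      go : ∀ {Z} → Acc _⊂_ Z → P Z → ∃ λ Z′ → Z′ ⊆ Z × P Z′ × (∀ Z″ → Z″ ⊂ Z′ → ¬ P Z″)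
      go {Z} (acc smaller) pZ with anySubset? (λ Z′ → Z′ ⊂? Z ×-dec P? Z′)
      ... | yes (Z′ , Z′⊂Z , pZ′) with Z″ , Z″⊆Z′ , minimal ← go (smaller Z′⊂Z) pZ′
        = Z″ , proj₁ Z′⊂Z ∘ Z″⊆Z′ , minimal
      ... | no ∄Z′ = Z , id , pZ , λ Z′ Z′⊂Z pZ′ → ∄Z′ (Z′ , Z′⊂Z , pZ′)

module _ {p} {P : Pred (Fin n) p} (P? : Decidable P) where

  subsetOf : Subset n
  subsetOf = Vec.tabulate (does ∘ P?)

  ∈-subsetOf⁺ : ∀ {x} → P x → x ∈ subsetOf
  ∈-subsetOf⁺ {x} px = lookup⇒[]= x subsetOf (trans (lookup∘tabulate _ x) (dec-true (P? x) px))

  ∈-subsetOf⁻ : ∀ {x} → x ∈ subsetOf → P x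
  ∈-subsetOf⁻ {x} x∈ with P? x | trans (sym (lookup∘tabulate (does ∘ P?) x)) ([]=⇒lookup x∈)
  ... | yes px | _  = px
  ... | no  _  | ()

module _ {n : ℕ} (G : Graph n) where

  open MembershipDec (_≟_ {n}) using () renaming (_∈?_ to _∈ₗ?_)
  open UniqueDec (_≟_ {n}) using (unique?)

  isWalk? : Decidable (IsWalk G)
  isWalk? []           = yes []
  isWalk? (x ∷ [])     = yes [ x ]
  isWalk? (x ∷ y ∷ xs) with adj? G x y | isWalk? (y ∷ xs)
  ... | yes x~y | yes w = yes (x~y ∷ w)
  ... | no  x≁y | _     = no λ { (x~y ∷ _) → x≁y x~y }
  ... | yes _   | no ¬w = no λ { (_ ∷ w) → ¬w w }

  AvoidingPath : Fin n → Fin n → Subset n → Set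
  AvoidingPath s t Z = Σ (Path G s t) λ P → Avoids G P Z

  avoidingPath? : ∀ s t Z → Dec (AvoidingPath s t Z)
  avoidingPath? s t Z = map′
    (λ (xs , w , u , h , l , av) → record { verts = xs ; walk = w ; unique = u ; start = h ; end = l } , av)
    (λ (P , av) → verts P , walk P , unique P , start P , end P , av)
    (bounded-any? isAvoidingPath? n (Unique⇒length≤ ∘ proj₁ ∘ proj₂))
    where
      IsAvoidingPath : List (Fin n) → Set
      IsAvoidingPath xs = IsWalk G xs × Unique xs × head xs ≡ just s × last xs ≡ just t × All (_∉ Z) xs

      isAvoidingPath? : Decidable IsAvoidingPath
      isAvoidingPath? xs = isWalk? xs ×-dec unique? xs ×-dec Maybe.≡-dec _≟_ (head xs) (just s)
        ×-dec Maybe.≡-dec _≟_ (last xs) (just t) ×-dec all? (¬? ∘ (_∈? Z)) xs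

  isSeparator? : ∀ s t → Decidable (IsSeparator G s t)
  isSeparator? s t Z = ¬? (s ∈? Z) ×-dec ¬? (t ∈? Z) ×-dec map′ curry uncurry (¬? (avoidingPath? s t Z))

  ¬isSeparator⇒avoidingPath : ∀ {s t Z} → s ∉ Z → t ∉ Z → ¬ IsSeparator G s t Z → AvoidingPath s t Z
  ¬isSeparator⇒avoidingPath {s} {t} {Z} s∉Z t∉Z ¬sep =
    decidable-stable (avoidingPath? s t Z) λ ∄P → ¬sep (s∉Z , t∉Z , curry ∄P)

  minimalSeparator-⊆ : ∀ {s t Z} → IsSeparator G s t Z → ∃ λ Z′ → Z′ ⊆ Z × IsMinimalSeparator G s t Z′
  minimalSeparator-⊆ {s} {t} = ⊂-minimal-⊆ (isSeparator? s t)

  data Chordless : List (Fin n) → Set where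
    []  : Chordless []
    [_] : ∀ x → Chordless (x ∷ [])
    _∷_ : ∀ {x y zs} → All (¬_ ∘ Adj G x) zs → Chordless (y ∷ zs) → Chordless (x ∷ y ∷ zs)

  Chordless⇒adjacent-consecutive : ∀ {xs} → Chordless xs →
                                   ∀ i j → Adj G (lookup xs i) (lookup xs j) →
                                   suc (toℕ i) ≡ toℕ j ⊎ suc (toℕ j) ≡ toℕ i
  Chordless⇒adjacent-consecutive [ _ ]    fzero           fzero           x~x = ⊥-elim (irrefl G x~x)
  Chordless⇒adjacent-consecutive (_ ∷ _)  fzero           fzero           x~x = ⊥-elim (irrefl G x~x)
  Chordless⇒adjacent-consecutive (_ ∷ _)  fzero           (fsuc fzero)    _   = inj₁ refl
  Chordless⇒adjacent-consecutive (_ ∷ _)  (fsuc fzero)    fzero           _   = inj₂ refl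
  Chordless⇒adjacent-consecutive (x≁ ∷ _) fzero           (fsuc (fsuc j)) x~z =
    contradiction x~z (All.lookup x≁ (∈-lookup j))
  Chordless⇒adjacent-consecutive (x≁ ∷ _) (fsuc (fsuc i)) fzero           z~x =
    contradiction (Graph.sym G z~x) (All.lookup x≁ (∈-lookup i))
  Chordless⇒adjacent-consecutive (_ ∷ c) (fsuc i) (fsuc j) a with Chordless⇒adjacent-consecutive c i j a
  ... | inj₁ eq = inj₁ (cong suc eq)
  ... | inj₂ eq = inj₂ (cong suc eq)

  IsChordlessWalk : List (Fin n) → Set
  IsChordlessWalk xs = IsWalk G xs × Unique xs × Chordless xs

  IsChordlessWalk-tail : TailClosed IsChordlessWalk
  IsChordlessWalk-tail (w , _ ∷ u , c) = walk-tail w , u , chordless-tail c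
    where
      walk-tail : ∀ {x xs} → IsWalk G (x ∷ xs) → IsWalk G xs
      walk-tail [ _ ]   = []
      walk-tail (_ ∷ w) = w
      chordless-tail : ∀ {x xs} → Chordless (x ∷ xs) → Chordless xs
      chordless-tail [ _ ]   = []
      chordless-tail (_ ∷ c) = c

  chordlessShortcut : ∀ x xs → IsWalk G (x ∷ xs) → Unique (x ∷ xs) →
                      ∃ λ ys → IsChordlessWalk (x ∷ ys) × last (x ∷ ys) ≡ last (x ∷ xs) × ys ⊆ₗ xs
  chordlessShortcut x []       _         _        = [] , ([ x ] , [] ∷ [] , [ x ]) , refl , id
  chordlessShortcut x (y ∷ xs) (x~y ∷ w) (x∉ ∷ u)
    with ys , cw , same-last , ys⊆xs ← chordlessShortcut y xs w u
    with pre , z , r , split , x~z , x≁r ← splitAtLast (adj? G x) {y ∷ ys} (here x~y)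
    with w′ , u′ , c′ ← TailClosed⇒++⁻ʳ {P = IsChordlessWalk} IsChordlessWalk-tail pre
                                         (subst IsChordlessWalk split cw)
    = z ∷ r , (x~z ∷ w′ , anti-mono z∷r⊆y∷xs x∉ ∷ u′ , x≁r ∷ c′) , z∷r-last , z∷r⊆y∷xs
    where
      z∷r⊆y∷xs : z ∷ r ⊆ₗ y ∷ xs
      z∷r⊆y∷xs = ∷⁺ʳ y ys⊆xs ∘ subst (_ ∈ₗ_) (sym split) ∘ xs⊆ys++xs (z ∷ r) pre

      open ≡-Reasoning
      z∷r-last : last (z ∷ r) ≡ last (y ∷ xs)
      z∷r-last = begin
        last (z ∷ r)         ≡⟨ last-++ pre r ⟨
        last (pre ++ z ∷ r)  ≡⟨ cong last split ⟨
        last (y ∷ ys)        ≡⟨ same-last ⟩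
        last (y ∷ xs)        ∎

  inducedSubpath : ∀ {s t} (P : Path G s t) → Σ (Path G s t) λ Q → Induced G Q × verts Q ⊆ₗ verts P
  inducedSubpath record { verts = [] ; start = () }
  inducedSubpath record { verts = x ∷ xs ; walk = w ; unique = u ; start = refl ; end = e }
    with ys , (w′ , u′ , c′) , same-last , ys⊆xs ← chordlessShortcut x xs w u
    = record { verts = x ∷ ys ; walk = w′ ; unique = u′ ; start = refl ; end = trans same-last e }
    , Chordless⇒adjacent-consecutive c′ , ∷⁺ʳ x ys⊆xs

  minimalSeparator⇒inducedPath : ∀ {s t v Z} → IsMinimalSeparator G s t Z → v ∈ Z →
                                 Σ (Path G s t) λ P → Induced G P × v ∈ₗ verts P
  minimalSeparator⇒inducedPath {v = v} {Z} ((s∉Z , t∉Z , separates) , minimal) v∈Z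
    with P , P-avoids ← ¬isSeparator⇒avoidingPath (s∉Z ∘ p─q⊆p Z ⁅ v ⁆) (t∉Z ∘ p─q⊆p Z ⁅ v ⁆)
                                                   (minimal (Z - v) (x∈p⇒p-x⊂p v∈Z))
    with Q , Q-induced , Q⊆P ← inducedSubpath P
    with v ∈ₗ? verts Q
  ... | yes v∈Q = Q , Q-induced , v∈Q
  ... | no  v∉Q = contradiction Q-avoids (separates Q)
    where
      Q-avoids : Avoids G Q Z
      Q-avoids = All.tabulate λ x∈Q x∈Z →
        All.lookup P-avoids (Q⊆P x∈Q) (x∈p∧x≢y⇒x∈p-y x∈Z λ { refl → v∉Q x∈Q })

  closed⇒separator : ∀ {ℓ} (X : Pred (Fin n) ℓ) {s t Z} → (∀ {x y} → X x → Adj G x y → y ∉ Z → X y) →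
                     X s → ¬ X t → s ∉ Z → t ∉ Z → IsSeparator G s t Z
  closed⇒separator X {s} {t} {Z} step Xs ¬Xt s∉Z t∉Z = s∉Z , t∉Z , no-path
    where
      reaches : ∀ {x xs y} → IsWalk G (x ∷ xs) → All (_∉ Z) xs → X x → last (x ∷ xs) ≡ just y → X y
      reaches [ _ ]     []         Xx refl = Xx
      reaches (x~y ∷ w) (y∉Z ∷ av) Xx eq   = reaches w av (step Xx x~y y∉Z) eq

      no-path : (P : Path G s t) → ¬ Avoids G P Z
      no-path record { verts = [] ; start = () }
      no-path record { verts = _ ∷ _ ; walk = w ; start = refl ; end = e } (_ ∷ av) =
        ¬Xt (reaches w av Xs e)

  OnPathExcept : ∀ {s t} → Path G s t → Fin n → Pred (Fin n) _
  OnPathExcept P v x = x ∈ₗ verts P × x ≢ v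

  onPathExcept? : ∀ {s t} (P : Path G s t) v → Decidable (OnPathExcept P v)
  onPathExcept? P v x = x ∈ₗ? verts P ×-dec ¬? (x ≟ v)

  offPath : ∀ {s t} → Path G s t → Fin n → Subset n
  offPath P v = ∁ (subsetOf (onPathExcept? P v))

  module _ {s t v : Fin n} {P : Path G s t} where

    ∉offPath⁺ : ∀ {x} → x ∈ₗ verts P → x ≢ v → x ∉ offPath P v
    ∉offPath⁺ x∈P x≢v = x∈p⇒x∉∁p (∈-subsetOf⁺ (onPathExcept? P v) (x∈P , x≢v))

    ∉offPath⁻ : ∀ {x} → x ∉ offPath P v → x ∈ₗ verts P × x ≢ v
    ∉offPath⁻ = ∈-subsetOf⁻ (onPathExcept? P v) ∘ x∉∁p⇒x∈p

  offPath-separates : ∀ {s t v} (P : Path G s t) → Induced G P → v ∈ₗ verts P →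
                      v ≢ s → v ≢ t → IsSeparator G s t (offPath P v)
  offPath-separates {s} {t} {v} P induced v∈P v≢s v≢t =
    closed⇒separator Before Before-closed Before-s ¬Before-t
      (∉offPath⁺ {P = P} (head⇒∈ (start P)) (v≢s ∘ sym))
      (∉offPath⁺ {P = P} (last⇒∈ (end P)) (v≢t ∘ sym))
    where
      k = Any.index v∈P

      Before : Pred (Fin n) _
      Before x = ∃ λ i → lookup (verts P) i ≡ x × toℕ i < toℕ k

      index-≢ : ∀ {i j x y} → lookup (verts P) i ≡ x → lookup (verts P) j ≡ y →
                x ≢ y → toℕ i ≢ toℕ j
      index-≢ refl refl x≢y eq = x≢y (cong (lookup (verts P)) (toℕ-injective eq))

      lookup-k : lookup (verts P) k ≡ v
      lookup-k = sym (lookup-index v∈P)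

      Before-s : Before s
      Before-s with i , lookup-i , i≡0 ← head⇒lookup-zero (start P)
        = i , lookup-i , subst (_< toℕ k) (sym i≡0)
            (n≢0⇒n>0 λ k≡0 → index-≢ lookup-k lookup-i v≢s (trans k≡0 (sym i≡0)))

      ¬Before-t : ¬ Before t
      ¬Before-t (i , lookup-i , i<k) =
        <⇒≱ i<k (Unique⇒last-index-maximal (unique P) (end P) i lookup-i k)

      Before-closed : ∀ {x y} → Before x → Adj G x y → y ∉ offPath P v → Before y
      Before-closed (i , lookup-i , i<k) x~y y∉offPath with y∈P , y≢v ← ∉offPath⁻ {P = P} y∉offPath
        = j , lookup-j , j<k (induced i j (subst₂ (Adj G) (sym lookup-i) (sym lookup-j) x~y))
        where
          j = Any.index y∈P
          lookup-j = sym (lookup-index y∈P)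
          j≢k = index-≢ lookup-j lookup-k y≢v
          j<k : suc (toℕ i) ≡ toℕ j ⊎ suc (toℕ j) ≡ toℕ i → toℕ j < toℕ k
          j<k (inj₁ i+1≡j) = ≤∧≢⇒< (subst (_≤ toℕ k) i+1≡j i<k) j≢k
          j<k (inj₂ j+1≡i) = <-trans (≤-reflexive j+1≡i) i<k

  inducedPath⇒minimalSeparator : ∀ {s t v} (P : Path G s t) → Induced G P → v ∈ₗ verts P →
                                 v ≢ s → v ≢ t → Σ (Subset n) λ Z → IsMinimalSeparator G s t Z × v ∈ Z
  inducedPath⇒minimalSeparator {v = v} P induced v∈P v≢s v≢t
    with Z , Z⊆offPath , Z-minimal@((_ , _ , separates) , _)
           ← minimalSeparator-⊆ (offPath-separates P induced v∈P v≢s v≢t)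
    with v ∈? Z
  ... | yes v∈Z = Z , Z-minimal , v∈Z
  ... | no  v∉Z = contradiction P-avoids (separates P)
    where
      P-avoids : Avoids G P Z
      P-avoids = All.tabulate λ x∈P x∈Z →
        ∉offPath⁺ {P = P} x∈P (λ { refl → v∉Z x∈Z }) (Z⊆offPath x∈Z)

lemma1 : ∀ {n : ℕ} (G : Graph n) (s t v : Fin n) →
    ¬ s ≡ t → ¬ v ≡ s → ¬ v ≡ t →
    (Σ (Subset n) (λ Z → IsMinimalSeparator G s t Z × v ∈ Z))
      ⇔ (Σ (Path G s t) (λ P → Induced G P × v ∈ₗ verts P))
lemma1 G s t v _ v≢s v≢t = mk⇔
  (λ (Z , Z-minimal , v∈Z) → minimalSeparator⇒inducedPath G Z-minimal v∈Z)
  (λ (P , induced , v∈P) → inducedPath⇒minimalSeparator G P induced v∈P v≢s v≢t)
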